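{- Let $M$ be a connected simple graph with $|V(M)|\ge 3$, and let $u\in V(M)$ be a vertex of degree two in $M$, with neighbors $u_1,u_2$ in $M$. Let $a\ge 1$ and let $H$ be the graph obtained from $M$ by attaching a path $P_a$ to $u$ (i.e., adding a new path on $a$ vertices and an edge between $u$ and one terminal vertex of this path), and let $u'$ be the pendant vertex of the attached path in $H$ (the other terminal vertex of the path, which is the attached vertex itself if $a=1$). If $\min\{d_H(u_1),d_H(u_2)\}\le 4$, then the graph $H'=H-\{uu_2\}+\{u'u_2\}$ (obtained by deleting the edge $uu_2$ and adding the edge $u'u_2$) satisfies $\chi(H')>\chi(H)$.
   Context: For a simple graph $G$ and vertex $v$, $d_v=d_G(v)$ denotes the degree of $v$. The sum-connectivity index of $G$ is $\chi(G)=\sum_{uv\in E(G)}(d_u+d_v)^{ -1/2}$. $P_a$ denotes the path on $a$ vertices. A pendant vertex is a vertex of degree one. -}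

module Defs where

open import Data.Bool using (Bool; true; false; if_then_else_; _∧_; _∨_; not)
open import Data.Nat using (ℕ; zero; suc; _+_; _*_; _^_; _≤_; _<_; _≤?_)
open import Data.Fin using (Fin; toℕ; splitAt; _↑ˡ_; _↑ʳ_; fromℕ; _≟_)
import Data.Nat as ℕ
open import Data.Nat.ListAction using (sum)
open import Data.List using (List; []; _∷_; map; filter; length; allFin; upTo; concatMap)
open import Data.Sum using (_⊎_; inj₁; inj₂)
open import Data.Product using (∃; _×_; _,_)
open import Relation.Binary.PropositionalEquality using (_≡_)
open import Relation.Nullary.Decidable using (⌊_⌋)

Adj : ℕ → Set
Adj n = Fin n → Fin n → Bool

IsSimple : ∀ {n} → Adj n → Set
IsSimple {n} G = (∀ (i j : Fin n) → G i j ≡ G j i) × (∀ (i : Fin n) → G i i ≡ false)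

data Reach {n : ℕ} (G : Adj n) : Fin n → Fin n → Set where
  here : ∀ {i} → Reach G i i
  step : ∀ {i j k} → G i j ≡ true → Reach G j k → Reach G i k

Connected : ∀ {n} → Adj n → Set
Connected {n} G = ∀ (i j : Fin n) → Reach G i j

deg : ∀ {n} → Adj n → Fin n → ℕ
deg {n} G v = sum (map (λ w → if G v w then 1 else 0) (allFin n))

edges : ∀ {n} → Adj n → List (Fin n × Fin n)
edges {n} G =
  concatMap (λ i → concatMap (λ j →
    if ⌊ suc (toℕ i) ≤? toℕ j ⌋ ∧ G i j then (i , j) ∷ [] else []) (allFin n)) (allFin n)

-- invSqrtLo N d = ⌊ N / √d ⌋ for d ≥ 1, i.e. the number of m ∈ {1..N} with m²·d ≤ N²
invSqrtLo : ℕ → ℕ → ℕ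
invSqrtLo N d = length (filter (λ m → suc m * suc m * d ≤? N * N) (upTo N))

-- Rational lower/upper bounds (scaled by N = 2^k) for χ(G):
--   χLo k G / 2^k ≤ χ(G) ≤ χHi k G / 2^k, and χHi k G − χLo k G = |E(G)|.
χLo : ∀ {n} → ℕ → Adj n → ℕ
χLo k G = sum (map (λ { (i , j) → invSqrtLo (2 ^ k) (deg G i + deg G j) }) (edges G))

χHi : ∀ {n} → ℕ → Adj n → ℕ
χHi k G = sum (map (λ { (i , j) → suc (invSqrtLo (2 ^ k) (deg G i + deg G j)) }) (edges G))

-- Strict real inequality χ(G) < χ(G'), in the (Bishop) constructive sense:
-- some rational separates them; equivalent to the real inequality since the
-- approximation error |E|/2^k tends to 0.
_χ<_ : ∀ {n m} → Adj n → Adj m → Set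
G χ< G' = ∃ λ k → χHi k G < χLo k G'

-- H = M with a path P_{suc b} attached to u (path vertices raise n p, p = 0..b;
-- path vertex 0 is joined to u).
attachPath : ∀ {n} (b : ℕ) → Adj n → Fin n → Adj (n + suc b)
attachPath {n} b M u x y with splitAt n x | splitAt n y
... | inj₁ i | inj₁ j = M i j
... | inj₁ i | inj₂ p = ⌊ i ≟ u ⌋ ∧ ⌊ toℕ p ℕ.≟ 0 ⌋
... | inj₂ p | inj₁ i = ⌊ i ≟ u ⌋ ∧ ⌊ toℕ p ℕ.≟ 0 ⌋
... | inj₂ p | inj₂ q = ⌊ suc (toℕ p) ℕ.≟ toℕ q ⌋ ∨ ⌊ suc (toℕ q) ℕ.≟ toℕ p ⌋

pendant : ∀ n (b : ℕ) → Fin (n + suc b)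
pendant n b = n ↑ʳ fromℕ b

samePair : ∀ {N} → Fin N → Fin N → Fin N → Fin N → Bool
samePair x y a c = (⌊ x ≟ a ⌋ ∧ ⌊ y ≟ c ⌋) ∨ (⌊ x ≟ c ⌋ ∧ ⌊ y ≟ a ⌋)

moveEdge : ∀ {N} → Adj N → Fin N → Fin N → Fin N → Fin N → Adj N
moveEdge G a c a' c' x y = (G x y ∧ not (samePair x y a c)) ∨ samePair x y a' c'

-- Only edges at u and at the pendant vertex u' change their weight (d_x + d_y)^(-1/2). For a ≥ 2 the
-- end-degree sums on these edges are 3 + d(u₁), 3 + d(u₂), 3 + 2 and 2 + 1 in H, against 2 + d(u₁),
-- 2 + d(u₂), 2 + 2 and 2 + 2 in H'; for a = 1 they are 3 + d(u₁), 3 + d(u₂), 3 + 1 against 2 + d(u₁),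
-- 2 + d(u₂), 2 + 2. Each (2 + d)^(-1/2) − (3 + d)^(-1/2) is positive, and for d ≤ 4 it exceeds
-- 1/√3 + 1/√5 − 1, which is all that the two path edges lose. The comparison is made on the rational
-- enclosures χLo/χHi at precision 2^(|E(H)| + 14): the values 2¹⁴/√d involved are bracketed between
-- integers, and the width |E(H)| of the enclosure of χ(H) is smaller than the margin 2^|E(H)|.

module Submission where

open import Defs
open import Data.Bool using (Bool; true; false; if_then_else_; _∧_; _∨_; not; T)
open import Data.Bool.Properties as Bool using (∧-identityʳ; ∧-zeroʳ; ∨-identityʳ; ∧-comm; ∨-comm)
open import Data.Empty using (⊥; ⊥-elim)
open import Data.Fin using (Fin; zero; suc; toℕ; _≟_; _↑ˡ_; _↑ʳ_; fromℕ; inject₁; splitAt)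
open import Data.Fin.Properties
  using (toℕ-injective; toℕ<n; toℕ-fromℕ; toℕ-inject₁; toℕ-↑ˡ; toℕ-↑ʳ; ↑ˡ-injective; ↑ʳ-injective;
         splitAt-↑ˡ; splitAt-↑ʳ; splitAt⁻¹-↑ˡ; splitAt⁻¹-↑ʳ)
open import Data.List using (List; []; _∷_; map; tabulate; concatMap; _++_; length; filter; applyUpTo)
open import Data.List.Properties using (map-++; filter-accept)
open import Data.List.Relation.Unary.All as All using (All; []; _∷_)
open import Data.List.Relation.Unary.AllPairs using (AllPairs; []; _∷_)
open import Data.List.Relation.Unary.Any as Any using (Any; here; there; any?)
import Data.Nat as ℕ
open import Data.Nat using (ℕ; zero; suc; _+_; _*_; _^_; _≤_; _<_; _⊓_; z≤n; s≤s; _≤ᵇ_)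
open import Data.Nat.ListAction using (sum)
open import Data.Nat.ListAction.Properties using (sum-++)
open import Data.Nat.Properties
  using (module ≤-Reasoning; +-0-commutativeMonoid; suc-injective; ≤ᵇ⇒≤;
         +-identityʳ; +-comm; +-assoc; +-suc; +-cancelʳ-≡; +-cancelʳ-<; *-distribˡ-+;
         ≤-refl; ≤-reflexive; ≤-trans; ≤-pred; <⇒≤; <⇒≢; ≰⇒>; <⇒≱; <-irrefl; <-asym; <-cmp; n≮n;
         n≤1+n; n<1+n; m≤n⇒m≤1+n; m<n⇒m<1+n; m≤m+n; m≤n+m; m≤m*n; m^n>0; ^-distribˡ-+-*; ⊓-sel;
         +-mono-≤; +-monoˡ-≤; +-monoʳ-≤; +-monoˡ-<; +-monoʳ-<;
         *-mono-≤; *-monoˡ-≤; *-monoʳ-≤; *-mono-<; *-monoˡ-<)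
open import Data.Nat.Solver using (module +-*-Solver)
open import Algebra.Properties.CommutativeMonoid.Sum +-0-commutativeMonoid
  using (sum-syntax; ∑-distrib-+; sum-cong-≗; sum-replicate-zero)
open import Data.Product using (Σ; _×_; _,_; proj₁; proj₂)
open import Data.Sum using (_⊎_; inj₁; inj₂; [_,_]′) renaming (map to map-⊎)
open import Data.Unit using (tt)
open import Function using (_∘_; _⇔_; mk⇔; Equivalence; case_of_)
open import Relation.Binary using (tri<; tri≈; tri>)
open import Relation.Binary.PropositionalEquality
open import Relation.Nullary using (Dec; yes; no; ¬_)
open import Relation.Nullary.Decidable using (⌊_⌋; ⌊⌋-map′; toSum)
open import Relation.Unary using (Decidable)

𝟙 : Bool → ℕ
𝟙 b = if b then 1 else 0

⌊⌋-true : ∀ {A : Set} (a? : Dec A) → A → ⌊ a? ⌋ ≡ true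
⌊⌋-true (yes _) _ = refl
⌊⌋-true (no ¬a) a = ⊥-elim (¬a a)

⌊⌋-false : ∀ {A : Set} (a? : Dec A) → ¬ A → ⌊ a? ⌋ ≡ false
⌊⌋-false (yes a) ¬a = ⊥-elim (¬a a)
⌊⌋-false (no _) _ = refl

⌊⌋-sound : ∀ {A : Set} (a? : Dec A) → ⌊ a? ⌋ ≡ true → A
⌊⌋-sound (yes a) _ = a

⌊⌋-⇔ : ∀ {A B : Set} → A ⇔ B → (a? : Dec A) (b? : Dec B) → ⌊ a? ⌋ ≡ ⌊ b? ⌋
⌊⌋-⇔ A⇔B (yes a) b? = sym (⌊⌋-true b? (Equivalence.to A⇔B a))
⌊⌋-⇔ A⇔B (no ¬a) b? = sym (⌊⌋-false b? (¬a ∘ Equivalence.from A⇔B))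

∧-true⇒ : ∀ {p q} → p ∧ q ≡ true → p ≡ true × q ≡ true
∧-true⇒ {true} {true} _ = refl , refl

∨-true⇒ : ∀ {p q} → p ∨ q ≡ true → p ≡ true ⊎ q ≡ true
∨-true⇒ {true} _ = inj₁ refl
∨-true⇒ {false} {true} _ = inj₂ refl

if-∨ : ∀ p q v → (p ≡ true → q ≡ true → ⊥) →
  (if p ∨ q then v else 0) ≡ (if p then v else 0) + (if q then v else 0)
if-∨ true true v excl = ⊥-elim (excl refl refl)
if-∨ true false v _ = sym (+-identityʳ v)
if-∨ false q v _ = refl

-- ⌊_⌋ is stuck on open decisions built with Dec.map′, so these hold only propositionally.
≟-suc : ∀ {n} (i j : Fin n) → ⌊ suc i ≟ suc j ⌋ ≡ ⌊ i ≟ j ⌋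
≟-suc i j = ⌊⌋-map′ _ _ (i ≟ j)

ℕ≟-suc : ∀ m n → ⌊ suc m ℕ.≟ suc n ⌋ ≡ ⌊ m ℕ.≟ n ⌋
ℕ≟-suc m n = ⌊⌋-⇔ (mk⇔ suc-injective (cong suc)) (suc m ℕ.≟ suc n) (m ℕ.≟ n)

ℕ≟-sym : ∀ m n → ⌊ m ℕ.≟ n ⌋ ≡ ⌊ n ℕ.≟ m ⌋
ℕ≟-sym m n = ⌊⌋-⇔ (mk⇔ sym sym) (m ℕ.≟ n) (n ℕ.≟ m)

<?-suc : ∀ m n → ⌊ suc m ℕ.<? suc n ⌋ ≡ ⌊ m ℕ.<? n ⌋
<?-suc m n = ⌊⌋-⇔ (mk⇔ ℕ.s<s⁻¹ s≤s) (suc m ℕ.<? suc n) (m ℕ.<? n)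

∑-mono-≤ : ∀ {n} {f g : Fin n → ℕ} → (∀ i → f i ≤ g i) → ∑[ i < n ] f i ≤ ∑[ i < n ] g i
∑-mono-≤ {zero} _ = z≤n
∑-mono-≤ {suc n} f≤g = +-mono-≤ (f≤g zero) (∑-mono-≤ (f≤g ∘ suc))

∑-zero : ∀ n → ∑[ i < n ] 0 ≡ 0
∑-zero = sum-replicate-zero

∑-δ : ∀ {n} (a : Fin n) (f : Fin n → ℕ) → ∑[ i < n ] (if ⌊ i ≟ a ⌋ then f i else 0) ≡ f a
∑-δ {suc n} zero f = trans (cong (f zero +_) (∑-zero n)) (+-identityʳ (f zero))
∑-δ {suc n} (suc a) f =
  trans (sum-cong-≗ {n} (λ i → cong (λ c → if c then f (suc i) else 0) (≟-suc i a))) (∑-δ a (f ∘ suc))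

∑-↑ : ∀ m {k} (f : Fin (m + k) → ℕ) →
  ∑[ x < m + k ] f x ≡ ∑[ i < m ] f (i ↑ˡ k) + ∑[ j < k ] f (m ↑ʳ j)
∑-↑ zero f = refl
∑-↑ (suc m) f = trans (cong (f zero +_) (∑-↑ m (f ∘ suc))) (sym (+-assoc (f zero) _ _))

∑-𝟙-toℕ : ∀ m t → ∑[ q < m ] 𝟙 ⌊ t ℕ.≟ toℕ q ⌋ ≡ 𝟙 ⌊ t ℕ.<? m ⌋
∑-𝟙-toℕ zero t = refl
∑-𝟙-toℕ (suc m) zero = cong suc (∑-zero m)
∑-𝟙-toℕ (suc m) (suc t) =
  trans (sum-cong-≗ {m} (λ q → cong 𝟙 (ℕ≟-suc t (toℕ q))))
        (trans (∑-𝟙-toℕ m t) (cong 𝟙 (sym (<?-suc t m))))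

∑-𝟙-shift : ∀ {n} {f g : Fin n → ℕ} (c : Fin n) → (∀ y → f y + 𝟙 ⌊ y ≟ c ⌋ ≡ g y) →
  ∑[ y < n ] f y + 1 ≡ ∑[ y < n ] g y
∑-𝟙-shift {n} {f} c f+δ≡g =
  trans (cong (∑[ y < n ] f y +_) (sym (∑-δ c (λ _ → 1))))
        (trans (sym (∑-distrib-+ {n} f _)) (sum-cong-≗ {n} f+δ≡g))

∑² : ∀ {N} → (Fin N → Fin N → ℕ) → ℕ
∑² {N} F = ∑[ i < N ] ∑[ j < N ] F i j

module _ {N : ℕ} where

  ∑²-cong : {F F' : Fin N → Fin N → ℕ} → (∀ i j → F i j ≡ F' i j) → ∑² F ≡ ∑² F'
  ∑²-cong F≡F' = sum-cong-≗ {N} (λ i → sum-cong-≗ {N} (F≡F' i))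

  ∑²-mono-≤ : {F F' : Fin N → Fin N → ℕ} → (∀ i j → F i j ≤ F' i j) → ∑² F ≤ ∑² F'
  ∑²-mono-≤ F≤F' = ∑-mono-≤ (λ i → ∑-mono-≤ (F≤F' i))

  ∑²-distrib-+ : (F F' : Fin N → Fin N → ℕ) → ∑² (λ i j → F i j + F' i j) ≡ ∑² F + ∑² F'
  ∑²-distrib-+ F F' = trans (sum-cong-≗ {N} (λ i → ∑-distrib-+ {N} (F i) (F' i))) (∑-distrib-+ {N} _ _)

  ∑²-zero : ∑² {N} (λ _ _ → 0) ≡ 0
  ∑²-zero = trans (sum-cong-≗ {N} (λ _ → ∑-zero N)) (∑-zero N)

  ∑²-δ : (x y : Fin N) (F : Fin N → Fin N → ℕ) →
    ∑² (λ i j → if ⌊ i ≟ x ⌋ ∧ ⌊ j ≟ y ⌋ then F i j else 0) ≡ F x y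
  ∑²-δ x y F = trans (sum-cong-≗ {N} row) (∑-δ x (λ i → F i y))
    where
    row : ∀ i → ∑[ j < N ] (if ⌊ i ≟ x ⌋ ∧ ⌊ j ≟ y ⌋ then F i j else 0)
                ≡ (if ⌊ i ≟ x ⌋ then F i y else 0)
    row i with ⌊ i ≟ x ⌋
    ... | true = ∑-δ y (F i)
    ... | false = ∑-zero N

sum-map-tabulate : ∀ {A : Set} {n} (g : Fin n → A) (f : A → ℕ) →
  sum (map f (tabulate g)) ≡ ∑[ i < n ] f (g i)
sum-map-tabulate {n = zero} g f = refl
sum-map-tabulate {n = suc n} g f = cong (f (g zero) +_) (sum-map-tabulate (g ∘ suc) f)

sum-map-concatMap : ∀ {A B : Set} (h : B → ℕ) (F : A → List B) xs →
  sum (map h (concatMap F xs)) ≡ sum (map (λ x → sum (map h (F x))) xs)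
sum-map-concatMap h F [] = refl
sum-map-concatMap h F (x ∷ xs) = begin
  sum (map h (F x ++ concatMap F xs))              ≡⟨ cong sum (map-++ h (F x) _) ⟩
  sum (map h (F x) ++ map h (concatMap F xs))      ≡⟨ sum-++ (map h (F x)) _ ⟩
  sum (map h (F x)) + sum (map h (concatMap F xs)) ≡⟨ cong (sum (map h (F x)) +_) (sum-map-concatMap h F xs) ⟩
  sum (map h (F x)) + sum (map (λ x → sum (map h (F x))) xs) ∎
  where open ≡-Reasoning

sum-map-if : ∀ {B : Set} (h : B → ℕ) c x → sum (map h (if c then x ∷ [] else [])) ≡ (if c then h x else 0)
sum-map-if h true x = +-identityʳ (h x)
sum-map-if h false x = refl

sum-map-suc : ∀ {A : Set} (h : A → ℕ) xs → sum (map (suc ∘ h) xs) ≡ sum (map h xs) + length xs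
sum-map-suc h [] = refl
sum-map-suc h (x ∷ xs) = begin
  suc (h x + sum (map (suc ∘ h) xs))  ≡⟨ cong (λ s → suc (h x + s)) (sum-map-suc h xs) ⟩
  suc (h x + (sum (map h xs) + length xs)) ≡⟨ cong suc (sym (+-assoc (h x) _ _)) ⟩
  suc (h x + sum (map h xs) + length xs)   ≡⟨ sym (+-suc _ (length xs)) ⟩
  h x + sum (map h xs) + suc (length xs) ∎
  where open ≡-Reasoning

deg-∑ : ∀ {N} (G : Adj N) v → deg G v ≡ ∑[ w < N ] 𝟙 (G v w)
deg-∑ G v = sum-map-tabulate (λ w → w) (λ w → 𝟙 (G v w))

module _ {N : ℕ} where

  deg-cong : ∀ {G G' : Adj N} {x x'} → (∀ y → G x y ≡ G' x' y) → deg G x ≡ deg G' x'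
  deg-cong {G} {G'} {x} {x'} eq =
    trans (deg-∑ G x) (trans (sum-cong-≗ {N} (cong 𝟙 ∘ eq)) (sym (deg-∑ G' x')))

  deg-shift : ∀ {G G' : Adj N} {x x'} (c : Fin N) →
    (∀ y → 𝟙 (G x y) + 𝟙 ⌊ y ≟ c ⌋ ≡ 𝟙 (G' x' y)) → deg G x + 1 ≡ deg G' x'
  deg-shift {G} {G'} {x} {x'} c row =
    trans (cong (_+ 1) (deg-∑ G x)) (trans (∑-𝟙-shift c row) (sym (deg-∑ G' x')))

adjacent-≢ : ∀ {N} {G : Adj N} → (∀ i → G i i ≡ false) → ∀ {i j} → G i j ≡ true → i ≢ j
adjacent-≢ loopless Gij refl = case trans (sym Gij) (loopless _) of λ ()

module _ {N : ℕ} (G : Adj N) where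

  deg-≥3 : ∀ {x y₁ y₂ y₃} → G x y₁ ≡ true → G x y₂ ≡ true → G x y₃ ≡ true →
    y₁ ≢ y₂ → y₁ ≢ y₃ → y₂ ≢ y₃ → 3 ≤ deg G x
  deg-≥3 {x} {y₁} {y₂} {y₃} G₁ G₂ G₃ y₁≢y₂ y₁≢y₃ y₂≢y₃ = begin
    3
      ≡⟨ cong₂ _+_ (cong₂ _+_ (∑-δ y₁ _) (∑-δ y₂ _)) (∑-δ y₃ _) ⟨
    ∑[ w < N ] δ₁ w + ∑[ w < N ] δ₂ w + ∑[ w < N ] δ₃ w
      ≡⟨ cong (_+ ∑[ w < N ] δ₃ w) (∑-distrib-+ {N} δ₁ δ₂) ⟨
    ∑[ w < N ] (δ₁ w + δ₂ w) + ∑[ w < N ] δ₃ w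
      ≡⟨ ∑-distrib-+ {N} (λ w → δ₁ w + δ₂ w) δ₃ ⟨
    ∑[ w < N ] (δ₁ w + δ₂ w + δ₃ w)
      ≤⟨ ∑-mono-≤ at ⟩
    ∑[ w < N ] 𝟙 (G x w)
      ≡⟨ deg-∑ G x ⟨
    deg G x ∎
    where
    open ≤-Reasoning
    δ₁ δ₂ δ₃ : Fin N → ℕ
    δ₁ w = if ⌊ w ≟ y₁ ⌋ then 1 else 0
    δ₂ w = if ⌊ w ≟ y₂ ⌋ then 1 else 0
    δ₃ w = if ⌊ w ≟ y₃ ⌋ then 1 else 0
    at : ∀ w → δ₁ w + δ₂ w + δ₃ w ≤ 𝟙 (G x w)
    at w with w ≟ y₁ | w ≟ y₂ | w ≟ y₃
    ... | yes refl | yes w≡y₂ | _ = ⊥-elim (y₁≢y₂ w≡y₂)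
    ... | yes refl | no _ | yes w≡y₃ = ⊥-elim (y₁≢y₃ w≡y₃)
    ... | yes refl | no _ | no _ rewrite G₁ = ≤-refl
    ... | no _ | yes refl | yes w≡y₃ = ⊥-elim (y₂≢y₃ w≡y₃)
    ... | no _ | yes refl | no _ rewrite G₂ = ≤-refl
    ... | no _ | no _ | yes refl rewrite G₃ = ≤-refl
    ... | no _ | no _ | no _ = z≤n

  neighbours-of-deg-2 : ∀ {x y₁ y₂} → deg G x ≡ 2 → G x y₁ ≡ true → G x y₂ ≡ true →
    y₁ ≢ y₂ → ∀ {v} → G x v ≡ true → v ≡ y₁ ⊎ v ≡ y₂
  neighbours-of-deg-2 {x} {y₁} {y₂} deg≡2 G₁ G₂ y₁≢y₂ {v} Gv with v ≟ y₁ | v ≟ y₂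
  ... | yes v≡y₁ | _ = inj₁ v≡y₁
  ... | no _ | yes v≡y₂ = inj₂ v≡y₂
  ... | no v≢y₁ | no v≢y₂ =
    ⊥-elim (n≮n 2 (subst (2 <_) deg≡2 (deg-≥3 G₁ G₂ Gv y₁≢y₂ (v≢y₁ ∘ sym) (v≢y₂ ∘ sym))))

module _ {N : ℕ} (G : Adj N) (f : ℕ → ℕ) where

  edgeSum : ℕ
  edgeSum = sum (map (λ e → f (deg G (proj₁ e) + deg G (proj₂ e))) (edges G))

  cell : Fin N → Fin N → ℕ
  cell i j = if ⌊ suc (toℕ i) ℕ.≤? toℕ j ⌋ ∧ G i j then f (deg G i + deg G j) else 0

  edgeSum-cells : edgeSum ≡ ∑² cell
  edgeSum-cells = begin
    edgeSum                                         ≡⟨ sum-map-concatMap h row (tabulate (λ i → i)) ⟩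
    sum (map (λ i → sum (map h (row i))) (tabulate (λ i → i)))
                                                    ≡⟨ sum-map-tabulate {n = N} (λ i → i) _ ⟩
    ∑[ i < N ] sum (map h (row i))                  ≡⟨ sum-cong-≗ {N} (λ i → trans
                                                         (sum-map-concatMap h (entry i) (tabulate (λ j → j)))
                                                         (sum-map-tabulate {n = N} (λ j → j) _)) ⟩
    ∑[ i < N ] ∑[ j < N ] sum (map h (entry i j))   ≡⟨ ∑²-cong (λ i j → sum-map-if h _ (i , j)) ⟩
    ∑² cell ∎
    where
    open ≡-Reasoning
    h : Fin N × Fin N → ℕ
    h e = f (deg G (proj₁ e) + deg G (proj₂ e))
    entry : Fin N → Fin N → List (Fin N × Fin N)
    entry i j = if ⌊ suc (toℕ i) ℕ.≤? toℕ j ⌋ ∧ G i j then (i , j) ∷ [] else []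
    row : Fin N → List (Fin N × Fin N)
    row i = concatMap (entry i) (tabulate (λ j → j))

edgeSum-suc : ∀ {N} (G : Adj N) f → edgeSum G (suc ∘ f) ≡ edgeSum G f + length (edges G)
edgeSum-suc G f = sum-map-suc (λ e → f (deg G (proj₁ e) + deg G (proj₂ e))) (edges G)

χHi-edgeSum : ∀ {N} k (G : Adj N) → χHi k G ≡ edgeSum G (invSqrtLo (2 ℕ.^ k)) + length (edges G)
χHi-edgeSum k G = edgeSum-suc G (invSqrtLo (2 ℕ.^ k))

module _ {N : ℕ} (G : Adj N) (f : ℕ → ℕ) where

  cell-non-edge : ∀ {i j} → G i j ≡ false → cell G f i j ≡ 0
  cell-non-edge {i} {j} Gij rewrite Gij | ∧-zeroʳ ⌊ suc (toℕ i) ℕ.≤? toℕ j ⌋ = refl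

  cell-cong : ∀ {G' : Adj N} {i j} → G' i j ≡ G i j → deg G' i ≡ deg G i → deg G' j ≡ deg G j →
    cell G' f i j ≡ cell G f i j
  cell-cong G'ij di dj rewrite G'ij | di | dj = refl

module _ {N : ℕ} where

  SamePair : Fin N → Fin N → Fin N → Fin N → Set
  SamePair x y a c = (x ≡ a × y ≡ c) ⊎ (x ≡ c × y ≡ a)

  samePair-sound : ∀ {x y a c} → samePair x y a c ≡ true → SamePair x y a c
  samePair-sound {x} {y} {a} {c} eq with x ≟ a | y ≟ c | x ≟ c | y ≟ a
  ... | yes x≡a | yes y≡c | _ | _ = inj₁ (x≡a , y≡c)
  ... | yes _ | no _ | yes x≡c | yes y≡a = inj₂ (x≡c , y≡a)
  ... | no _ | _ | yes x≡c | yes y≡a = inj₂ (x≡c , y≡a)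

  samePair-complete : ∀ {x y a c} → SamePair x y a c → samePair x y a c ≡ true
  samePair-complete {x} {y} (inj₁ (refl , refl))
    rewrite ⌊⌋-true (x ≟ x) refl | ⌊⌋-true (y ≟ y) refl = refl
  samePair-complete {x} {y} (inj₂ (refl , refl))
    rewrite ⌊⌋-true (x ≟ x) refl | ⌊⌋-true (y ≟ y) refl = ∨-comm (⌊ x ≟ y ⌋ ∧ ⌊ y ≟ x ⌋) true

  samePair-false : ∀ {x y a c} → ¬ SamePair x y a c → samePair x y a c ≡ false
  samePair-false {x} {y} {a} {c} ¬same with samePair x y a c in eq
  ... | true = ⊥-elim (¬same (samePair-sound eq))
  ... | false = refl

  samePair-swap : ∀ (x y a c : Fin N) → samePair x y a c ≡ samePair y x a c
  samePair-swap x y a c = trans (cong₂ _∨_ (∧-comm ⌊ x ≟ a ⌋ _) (∧-comm ⌊ x ≟ c ⌋ _))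
                                (∨-comm (⌊ y ≟ c ⌋ ∧ ⌊ x ≟ a ⌋) (⌊ y ≟ a ⌋ ∧ ⌊ x ≟ c ⌋))

module _ {N : ℕ} where

  onPair : Fin N × Fin N → Fin N → Fin N → Bool
  onPair (x , y) i j = samePair i j x y

  onPair-here : ∀ (x y : Fin N) → onPair (x , y) x y ≡ true
  onPair-here x y = samePair-complete {x = x} {y = y} (inj₁ (refl , refl))

  onPair-flip : ∀ (x y : Fin N) → onPair (x , y) y x ≡ true
  onPair-flip x y = samePair-complete {x = y} {y = x} (inj₂ (refl , refl))

  onPair-swap : ∀ q (i j : Fin N) → onPair q i j ≡ onPair q j i
  onPair-swap (x , y) i j = samePair-swap i j x y

  Apart : Fin N × Fin N → Fin N × Fin N → Set
  Apart q q' = ∀ i j → onPair q i j ≡ true → onPair q' i j ≡ false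

  apart : ∀ {x y x' y'} → ¬ (x ≡ x' × y ≡ y') → ¬ (x ≡ y' × y ≡ x') → Apart (x , y) (x' , y')
  apart {x} {y} {x'} {y'} ¬same ¬swapped i j on =
    samePair-false (λ same' → [ ¬same , ¬swapped ]′ (link (samePair-sound on) same'))
    where
    link : SamePair i j x y → SamePair i j x' y' → SamePair x y x' y'
    link (inj₁ (refl , refl)) (inj₁ (refl , refl)) = inj₁ (refl , refl)
    link (inj₁ (refl , refl)) (inj₂ (refl , refl)) = inj₂ (refl , refl)
    link (inj₂ (refl , refl)) (inj₁ (refl , refl)) = inj₂ (refl , refl)
    link (inj₂ (refl , refl)) (inj₂ (refl , refl)) = inj₁ (refl , refl)

  listed : List (Fin N × Fin N) → (Fin N → Fin N → ℕ) → Fin N → Fin N → ℕ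
  listed qs F i j = sum (map (λ q → if onPair q i j then F i j else 0) qs)

  listed-≥ : ∀ {qs} F i j → Any (λ q → onPair q i j ≡ true) qs → F i j ≤ listed qs F i j
  listed-≥ F i j (here on) rewrite on = m≤m+n (F i j) _
  listed-≥ F i j (there any) = ≤-trans (listed-≥ F i j any) (m≤n+m _ _)

  listed-zero : ∀ {qs} F i j → All (λ q → onPair q i j ≡ false) qs → listed qs F i j ≡ 0
  listed-zero F i j [] = refl
  listed-zero F i j (off ∷ offs) rewrite off = listed-zero F i j offs

  listed-≤ : ∀ {qs} F i j → AllPairs Apart qs → listed qs F i j ≤ F i j
  listed-≤ F i j [] = z≤n
  listed-≤ {q ∷ qs} F i j (apart-q ∷ apart-qs) with onPair q i j in on
  ... | true = ≤-reflexive (trans (cong (F i j +_) (listed-zero F i j (All.map (λ ap → ap i j on) apart-q)))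
                                 (+-identityʳ (F i j)))
  ... | false = listed-≤ F i j apart-qs

  pairPart : Fin N × Fin N → (Fin N → Fin N → ℕ) → ℕ
  pairPart q F = ∑² (λ i j → if onPair q i j then F i j else 0)

  ∑²-listed : ∀ qs F → ∑² (listed qs F) ≡ sum (map (λ q → pairPart q F) qs)
  ∑²-listed [] F = ∑²-zero {N}
  ∑²-listed (q ∷ qs) F = trans (∑²-distrib-+ {N} _ _) (cong (pairPart q F +_) (∑²-listed qs F))

pairSum : ∀ {N} → Adj N → (ℕ → ℕ) → List (Fin N × Fin N) → ℕ
pairSum G f qs = sum (map (λ q → pairPart q (cell G f)) qs)

module _ {N : ℕ} (G : Adj N) (G-sym : ∀ x y → G x y ≡ G y x) (f : ℕ → ℕ) where

  cell-pair : ∀ {x y} → x ≢ y →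
    cell G f x y + cell G f y x ≡ (if G x y then f (deg G x + deg G y) else 0)
  cell-pair {x} {y} x≢y rewrite G-sym y x with <-cmp (toℕ x) (toℕ y)
  ... | tri< x<y _ y≮x
    rewrite ⌊⌋-true (suc (toℕ x) ℕ.≤? toℕ y) x<y | ⌊⌋-false (suc (toℕ y) ℕ.≤? toℕ x) y≮x
    = +-identityʳ _
  ... | tri≈ _ x≡y _ = ⊥-elim (x≢y (toℕ-injective x≡y))
  ... | tri> x≮y _ y<x
    rewrite ⌊⌋-false (suc (toℕ x) ℕ.≤? toℕ y) x≮y | ⌊⌋-true (suc (toℕ y) ℕ.≤? toℕ x) y<x
          | +-comm (deg G y) (deg G x) = refl

  pairPart-edge : ∀ {x y dx dy} → x ≢ y → G x y ≡ true → deg G x ≡ dx → deg G y ≡ dy →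
    pairPart (x , y) (cell G f) ≡ f (dx + dy)
  pairPart-edge {x} {y} {dx} {dy} x≢y Gxy x-dx y-dy = begin
    pairPart (x , y) (cell G f)
      ≡⟨ ∑²-cong (λ i j → if-∨ (⌊ i ≟ x ⌋ ∧ ⌊ j ≟ y ⌋) _ (cell G f i j) (excl i j)) ⟩
    ∑² (λ i j → (if ⌊ i ≟ x ⌋ ∧ ⌊ j ≟ y ⌋ then cell G f i j else 0)
              + (if ⌊ i ≟ y ⌋ ∧ ⌊ j ≟ x ⌋ then cell G f i j else 0))
      ≡⟨ ∑²-distrib-+ {N} _ _ ⟩
    _ ≡⟨ cong₂ _+_ (∑²-δ x y (cell G f)) (∑²-δ y x (cell G f)) ⟩
    cell G f x y + cell G f y x
      ≡⟨ cell-pair x≢y ⟩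
    (if G x y then f (deg G x + deg G y) else 0)
      ≡⟨ cong (λ c → if c then f (deg G x + deg G y) else 0) Gxy ⟩
    f (deg G x + deg G y)
      ≡⟨ cong f (cong₂ _+_ x-dx y-dy) ⟩
    f (dx + dy) ∎
    where
    open ≡-Reasoning
    excl : ∀ i j → ⌊ i ≟ x ⌋ ∧ ⌊ j ≟ y ⌋ ≡ true → ⌊ i ≟ y ⌋ ∧ ⌊ j ≟ x ⌋ ≡ true → ⊥
    excl i j p q with i ≟ x | i ≟ y
    ... | yes refl | yes x≡y = x≢y x≡y

-- Moving one edge

module MoveEdge {N : ℕ} (G : Adj N) (G-sym : ∀ x y → G x y ≡ G y x) {a z a' : Fin N}
  (a≢z : a ≢ z) (a≢a' : a ≢ a') (z≢a' : z ≢ a') (Gaz : G a z ≡ true) (Ga'z : G a' z ≡ false) where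

  G' : Adj N
  G' = moveEdge G a z a' z

  G'-sym : ∀ x y → G' x y ≡ G' y x
  G'-sym x y rewrite G-sym x y | samePair-swap x y a z | samePair-swap x y a' z = refl

  G'-unchanged : ∀ {x y} → samePair x y a z ≡ false → samePair x y a' z ≡ false → G' x y ≡ G x y
  G'-unchanged {x} {y} p q rewrite p | q = trans (∨-identityʳ _) (∧-identityʳ (G x y))

  G'-outside : ∀ {x y} → x ≢ a → x ≢ a' → y ≢ a → y ≢ a' → G' x y ≡ G x y
  G'-outside x≢a x≢a' y≢a y≢a' =
    G'-unchanged (samePair-false [ x≢a ∘ proj₁ , y≢a ∘ proj₂ ]′)
                 (samePair-false [ x≢a' ∘ proj₁ , y≢a' ∘ proj₂ ]′)

  G'-row : ∀ {x} y → x ≢ a → x ≢ z → x ≢ a' → G' x y ≡ G x y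
  G'-row y x≢a x≢z x≢a' =
    G'-unchanged (samePair-false [ x≢a ∘ proj₁ , x≢z ∘ proj₁ ]′)
                 (samePair-false [ x≢a' ∘ proj₁ , x≢z ∘ proj₁ ]′)

  G'-a : ∀ {y} → y ≢ z → G' a y ≡ G a y
  G'-a y≢z =
    G'-unchanged (samePair-false [ y≢z ∘ proj₂ , a≢z ∘ proj₁ ]′)
                 (samePair-false [ a≢a' ∘ proj₁ , a≢z ∘ proj₁ ]′)

  G'-a'z : G' a' z ≡ true
  G'-a'z rewrite samePair-complete {x = a'} {y = z} {a = a'} {c = z} (inj₁ (refl , refl)) = ∨-comm _ true

  G'-az : G' a z ≡ false
  G'-az rewrite samePair-complete {x = a} {y = z} {a = a} {c = z} (inj₁ (refl , refl))
              | samePair-false {x = a} {y = z} {a = a'} {c = z} [ a≢a' ∘ proj₁ , a≢z ∘ proj₁ ]′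
              | Gaz = refl

  G'-a' : ∀ {y} → y ≢ z → G' a' y ≡ G a' y
  G'-a' y≢z =
    G'-unchanged (samePair-false [ a≢a' ∘ sym ∘ proj₁ , z≢a' ∘ sym ∘ proj₁ ]′)
                 (samePair-false [ y≢z ∘ proj₂ , z≢a' ∘ sym ∘ proj₁ ]′)

  G'-z : ∀ {y} → y ≢ a → y ≢ a' → G' z y ≡ G z y
  G'-z y≢a y≢a' =
    G'-unchanged (samePair-false [ a≢z ∘ sym ∘ proj₁ , y≢a ∘ proj₂ ]′)
                 (samePair-false [ z≢a' ∘ proj₁ , y≢a' ∘ proj₂ ]′)

  row-a : ∀ y → 𝟙 (G' a y) + 𝟙 ⌊ y ≟ z ⌋ ≡ 𝟙 (G a y)
  row-a y = [ (λ { refl → at-z }) , off-z ]′ (toSum (y ≟ z))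
    where
    at-z : 𝟙 (G' a z) + 𝟙 ⌊ z ≟ z ⌋ ≡ 𝟙 (G a z)
    at-z rewrite G'-az | Gaz | ⌊⌋-true (z ≟ z) refl = refl
    off-z : y ≢ z → 𝟙 (G' a y) + 𝟙 ⌊ y ≟ z ⌋ ≡ 𝟙 (G a y)
    off-z y≢z rewrite G'-a y≢z | ⌊⌋-false (y ≟ z) y≢z = +-identityʳ _

  row-a' : ∀ y → 𝟙 (G a' y) + 𝟙 ⌊ y ≟ z ⌋ ≡ 𝟙 (G' a' y)
  row-a' y = [ (λ { refl → at-z }) , off-z ]′ (toSum (y ≟ z))
    where
    at-z : 𝟙 (G a' z) + 𝟙 ⌊ z ≟ z ⌋ ≡ 𝟙 (G' a' z)
    at-z rewrite G'-a'z | Ga'z | ⌊⌋-true (z ≟ z) refl = refl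
    off-z : y ≢ z → 𝟙 (G a' y) + 𝟙 ⌊ y ≟ z ⌋ ≡ 𝟙 (G' a' y)
    off-z y≢z rewrite G'-a' y≢z | ⌊⌋-false (y ≟ z) y≢z = +-identityʳ _

  row-z : ∀ y → 𝟙 (G' z y) + 𝟙 ⌊ y ≟ a ⌋ ≡ 𝟙 (G z y) + 𝟙 ⌊ y ≟ a' ⌋
  row-z y = [ (λ { refl → at-a }) , (λ y≢a → [ (λ { refl → at-a' }) , off y≢a ]′ (toSum (y ≟ a'))) ]′
              (toSum (y ≟ a))
    where
    at-a : 𝟙 (G' z a) + 𝟙 ⌊ a ≟ a ⌋ ≡ 𝟙 (G z a) + 𝟙 ⌊ a ≟ a' ⌋
    at-a rewrite G'-sym z a | G'-az | G-sym z a | Gaz | ⌊⌋-true (a ≟ a) refl | ⌊⌋-false (a ≟ a') a≢a'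
      = refl
    at-a' : 𝟙 (G' z a') + 𝟙 ⌊ a' ≟ a ⌋ ≡ 𝟙 (G z a') + 𝟙 ⌊ a' ≟ a' ⌋
    at-a' rewrite G'-sym z a' | G'-a'z | G-sym z a' | Ga'z | ⌊⌋-true (a' ≟ a') refl
                | ⌊⌋-false (a' ≟ a) (a≢a' ∘ sym) = refl
    off : y ≢ a → y ≢ a' → 𝟙 (G' z y) + 𝟙 ⌊ y ≟ a ⌋ ≡ 𝟙 (G z y) + 𝟙 ⌊ y ≟ a' ⌋
    off y≢a y≢a' rewrite G'-z y≢a y≢a' | ⌊⌋-false (y ≟ a) y≢a | ⌊⌋-false (y ≟ a') y≢a' = refl

  deg-a : deg G' a + 1 ≡ deg G a
  deg-a = deg-shift {G = G'} {G' = G} z row-a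

  deg-a' : deg G a' + 1 ≡ deg G' a'
  deg-a' = deg-shift {G = G} {G' = G'} z row-a'

  deg-z : deg G' z ≡ deg G z
  deg-z = +-cancelʳ-≡ 1 _ _ (begin
    deg G' z + 1                                ≡⟨ cong (_+ 1) (deg-∑ G' z) ⟩
    ∑[ y < N ] 𝟙 (G' z y) + 1                  ≡⟨ ∑-𝟙-shift a row-z ⟩
    ∑[ y < N ] (𝟙 (G z y) + 𝟙 ⌊ y ≟ a' ⌋)      ≡⟨ sym (∑-𝟙-shift a' (λ _ → refl)) ⟩
    ∑[ y < N ] 𝟙 (G z y) + 1                   ≡⟨ cong (_+ 1) (sym (deg-∑ G z)) ⟩
    deg G z + 1 ∎)
    where open ≡-Reasoning

  deg-outside : ∀ {x} → x ≢ a → x ≢ a' → deg G' x ≡ deg G x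
  deg-outside {x} x≢a x≢a' =
    [ (λ { refl → deg-z }) , (λ x≢z → deg-cong {G = G'} {G' = G} (λ y → G'-row y x≢a x≢z x≢a')) ]′
      (toSum (x ≟ z))

-- Away from a and a' the cells of G and G' agree. The cells of edges at a or a' are covered by the
-- pairs in qs (possibly repeatedly) in G, and contain the pairwise distinct pairs qs' in G'.
module LocalChange {N : ℕ} (G G' : Adj N) (G-sym : ∀ x y → G x y ≡ G y x) {a a' : Fin N}
  (edges-outside : ∀ {x y} → x ≢ a → x ≢ a' → y ≢ a → y ≢ a' → G' x y ≡ G x y)
  (deg-outside : ∀ {x} → x ≢ a → x ≢ a' → deg G' x ≡ deg G x) where

  Covers : Fin N → List (Fin N × Fin N) → Set
  Covers x qs = ∀ y → G x y ≡ true → Any (λ q → onPair q x y ≡ true) qs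

  Meets : Fin N × Fin N → Set
  Meets (x , y) = (x ≡ a ⊎ x ≡ a') ⊎ (y ≡ a ⊎ y ≡ a')

  outside-meets : ∀ {i j} → i ≢ a → i ≢ a' → j ≢ a → j ≢ a' →
    ∀ {q} → Meets q → onPair q i j ≡ false
  outside-meets {i} {j} i≢a i≢a' j≢a j≢a' {x , y} m = samePair-false clash
    where
    avoid : ∀ {v} → v ≢ a → v ≢ a' → ¬ (v ≡ a ⊎ v ≡ a')
    avoid v≢a v≢a' = [ v≢a , v≢a' ]′
    clash : ¬ SamePair i j x y
    clash (inj₁ (refl , refl)) = [ avoid i≢a i≢a' , avoid j≢a j≢a' ]′ m
    clash (inj₂ (refl , refl)) = [ avoid j≢a j≢a' , avoid i≢a i≢a' ]′ m

  module _ (f : ℕ → ℕ) (qs qs' : List (Fin N × Fin N)) (covers-a : Covers a qs) (covers-a' : Covers a' qs)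
    (meets : All Meets qs') (apart' : AllPairs Apart qs') where

    cell-local : ∀ i j → cell G f i j + listed qs' (cell G' f) i j ≤ cell G' f i j + listed qs (cell G f) i j
    cell-local i j with any? (λ q → onPair q i j Bool.≟ true) qs
    ... | yes covered = begin
      cell G f i j + listed qs' (cell G' f) i j ≤⟨ +-mono-≤ (listed-≥ (cell G f) i j covered)
                                                            (listed-≤ (cell G' f) i j apart') ⟩
      listed qs (cell G f) i j + cell G' f i j  ≡⟨ +-comm (listed qs (cell G f) i j) (cell G' f i j) ⟩
      cell G' f i j + listed qs (cell G f) i j  ∎
      where open ≤-Reasoning
    ... | no uncovered = by-edge (G i j) refl
      where
      open ≤-Reasoning
      by-edge : ∀ e → G i j ≡ e →
        cell G f i j + listed qs' (cell G' f) i j ≤ cell G' f i j + listed qs (cell G f) i j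
      by-edge false Gij = begin
        cell G f i j + listed qs' (cell G' f) i j ≡⟨ cong (_+ _) (cell-non-edge G f Gij) ⟩
        listed qs' (cell G' f) i j                ≤⟨ listed-≤ (cell G' f) i j apart' ⟩
        cell G' f i j                             ≤⟨ m≤m+n (cell G' f i j) _ ⟩
        cell G' f i j + listed qs (cell G f) i j  ∎
      by-edge true Gij = begin
        cell G f i j + listed qs' (cell G' f) i j ≡⟨ cong₂ _+_ (sym same-cell) no-new-pair ⟩
        cell G' f i j + 0                         ≤⟨ +-monoʳ-≤ (cell G' f i j) z≤n ⟩
        cell G' f i j + listed qs (cell G f) i j  ∎
        where
        not-at : ∀ {x} → Covers x qs → i ≢ x
        not-at cov refl = uncovered (cov j Gij)
        not-at' : ∀ {x} → Covers x qs → j ≢ x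
        not-at' cov refl =
          uncovered (Any.map (λ {q} on → trans (onPair-swap q i j) on) (cov i (trans (G-sym j i) Gij)))
        same-cell : cell G' f i j ≡ cell G f i j
        same-cell = cell-cong G f (edges-outside (not-at covers-a) (not-at covers-a')
                                                 (not-at' covers-a) (not-at' covers-a'))
                                  (deg-outside (not-at covers-a) (not-at covers-a'))
                                  (deg-outside (not-at' covers-a) (not-at' covers-a'))
        no-new-pair : listed qs' (cell G' f) i j ≡ 0
        no-new-pair = listed-zero (cell G' f) i j
          (All.map (outside-meets (not-at covers-a) (not-at covers-a') (not-at' covers-a) (not-at' covers-a')) meets)

    edgeSum-local : edgeSum G f + pairSum G' f qs' ≤ edgeSum G' f + pairSum G f qs
    edgeSum-local = begin
      edgeSum G f + pairSum G' f qs'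
        ≡⟨ cong₂ _+_ (edgeSum-cells G f) (sym (∑²-listed qs' (cell G' f))) ⟩
      ∑² (cell G f) + ∑² (listed qs' (cell G' f))
        ≡⟨ sym (∑²-distrib-+ (cell G f) _) ⟩
      ∑² (λ i j → cell G f i j + listed qs' (cell G' f) i j)
        ≤⟨ ∑²-mono-≤ cell-local ⟩
      ∑² (λ i j → cell G' f i j + listed qs (cell G f) i j)
        ≡⟨ ∑²-distrib-+ (cell G' f) _ ⟩
      ∑² (cell G' f) + ∑² (listed qs (cell G f))
        ≡⟨ cong₂ _+_ (sym (edgeSum-cells G' f)) (∑²-listed qs (cell G f)) ⟩
      edgeSum G' f + pairSum G f qs ∎
      where open ≤-Reasoning

-- Rational bounds for 1/√d

module _ {P : ℕ → Set} (P? : Decidable P) where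

  count-≥ : ∀ (g : ℕ → ℕ) n t → t ≤ n → (∀ i → i < t → P (g i)) →
    t ≤ length (filter P? (applyUpTo g n))
  count-≥ g n zero _ _ = z≤n
  count-≥ g (suc n) (suc t) (s≤s t≤n) pass
    rewrite filter-accept P? {g 0} {applyUpTo (g ∘ suc) n} (pass 0 (s≤s z≤n)) =
    s≤s (count-≥ (g ∘ suc) n t t≤n (λ i i<t → pass (suc i) (s≤s i<t)))

  count-≤ : ∀ (g : ℕ → ℕ) n s → (∀ i → P (g i) → i < s) → length (filter P? (applyUpTo g n)) ≤ s
  count-≤ g zero s _ = z≤n
  count-≤ g (suc n) s only with P? (g 0)
  ... | no _ = count-≤ (g ∘ suc) n s (λ i → <⇒≤ ∘ only (suc i))
  ... | yes g0 = shift s only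
    where
    shift : ∀ s → (∀ i → P (g i) → i < s) → suc (length (filter P? (applyUpTo (g ∘ suc) n))) ≤ s
    shift zero only' with only' 0 g0
    ... | ()
    shift (suc s') only' = s≤s (count-≤ (g ∘ suc) n s' (λ i → ≤-pred ∘ only' (suc i)))

count-mono : ∀ {P Q : ℕ → Set} (P? : Decidable P) (Q? : Decidable Q) → (∀ {x} → P x → Q x) →
  ∀ xs → length (filter P? xs) ≤ length (filter Q? xs)
count-mono P? Q? P⇒Q [] = z≤n
count-mono P? Q? P⇒Q (x ∷ xs) with P? x | Q? x
... | yes _ | yes _ = s≤s (count-mono P? Q? P⇒Q xs)
... | yes p | no ¬q = ⊥-elim (¬q (P⇒Q p))
... | no _ | yes _ = m≤n⇒m≤1+n (count-mono P? Q? P⇒Q xs)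
... | no _ | no _ = count-mono P? Q? P⇒Q xs

invSqrtLo-antitone : ∀ N {d d'} → d ≤ d' → invSqrtLo N d' ≤ invSqrtLo N d
invSqrtLo-antitone N {d} {d'} d≤d' =
  count-mono (λ m → suc m * suc m * d' ℕ.≤? N * N) (λ m → suc m * suc m * d ℕ.≤? N * N)
             (λ {m} → ≤-trans (*-monoʳ-≤ (suc m * suc m) d≤d')) (applyUpTo (λ i → i) N)

module _ where
  open +-*-Solver

  square-scale : ∀ R l d → R * l * (R * l) * d ≡ R * R * (l * l * d)
  square-scale = solve 3 (λ R l d → R :* l :* (R :* l) :* d := R :* R :* (l :* l :* d)) refl

  square-swap : ∀ R Q → R * R * (Q * Q) ≡ R * Q * (R * Q)
  square-swap = solve 2 (λ R Q → R :* R :* (Q :* Q) := R :* Q :* (R :* Q)) refl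

invSqrtLo-≥ : ∀ R {Q l d} → l ≤ Q → l * l * d ≤ Q * Q → R * l ≤ invSqrtLo (R * Q) d
invSqrtLo-≥ R {Q} {l} {d} l≤Q l²d≤Q² =
  count-≥ (λ m → suc m * suc m * d ℕ.≤? R * Q * (R * Q)) (λ i → i) (R * Q) (R * l) (*-monoʳ-≤ R l≤Q)
          (λ i i<Rl → ≤-trans (*-monoˡ-≤ d (*-mono-≤ i<Rl i<Rl)) Rl²d≤RQ²)
  where
  open ≤-Reasoning
  Rl²d≤RQ² : R * l * (R * l) * d ≤ R * Q * (R * Q)
  Rl²d≤RQ² = begin
    R * l * (R * l) * d ≡⟨ square-scale R l d ⟩
    R * R * (l * l * d) ≤⟨ *-monoʳ-≤ (R * R) l²d≤Q² ⟩
    R * R * (Q * Q)     ≡⟨ square-swap R Q ⟩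
    R * Q * (R * Q)     ∎

invSqrtLo-≤ : ∀ R {Q u d} → 1 ≤ d → Q * Q ≤ u * u * d → invSqrtLo (R * Q) d ≤ R * u
invSqrtLo-≤ R {Q} {u} {d} 1≤d Q²≤u²d =
  count-≤ (λ m → suc m * suc m * d ℕ.≤? R * Q * (R * Q)) (λ i → i) (R * Q) (R * u) below
  where
  below : ∀ i → suc i * suc i * d ≤ R * Q * (R * Q) → i < R * u
  below i passes with R * u ℕ.≤? i
  ... | no Ru≰i = ≰⇒> Ru≰i
  ... | yes Ru≤i = ⊥-elim (<⇒≱ RQ²<i+1²d passes)
    where
    open ≤-Reasoning
    RQ²<i+1²d : R * Q * (R * Q) < suc i * suc i * d
    RQ²<i+1²d = begin-strict
      R * Q * (R * Q)     ≡⟨ square-swap R Q ⟨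
      R * R * (Q * Q)     ≤⟨ *-monoʳ-≤ (R * R) Q²≤u²d ⟩
      R * R * (u * u * d) ≡⟨ square-scale R u d ⟨
      R * u * (R * u) * d ≤⟨ *-monoˡ-≤ d (*-mono-≤ Ru≤i Ru≤i) ⟩
      i * i * d           <⟨ *-monoˡ-< d {{ℕ.>-nonZero 1≤d}} (*-mono-< (n<1+n i) (n<1+n i)) ⟩
      suc i * suc i * d   ∎

n<2^n : ∀ n → n < 2 ^ n
n<2^n zero = s≤s z≤n
n<2^n (suc n) = begin-strict
  suc n             ≡⟨ +-comm 1 n ⟩
  n + 1             <⟨ +-monoˡ-< 1 (n<2^n n) ⟩
  2 ^ n + 1         ≤⟨ +-monoʳ-≤ (2 ^ n) (m^n>0 2 n) ⟩
  2 ^ n + 2 ^ n     ≡⟨ cong (2 ^ n +_) (+-identityʳ (2 ^ n)) ⟨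
  2 ^ suc n         ∎
  where open ≤-Reasoning

ψ : ℕ → ℕ → ℕ
ψ e = invSqrtLo (2 ^ (e + 14))

ψ-antitone : ∀ e {d d'} → d ≤ d' → ψ e d' ≤ ψ e d
ψ-antitone e = invSqrtLo-antitone (2 ^ (e + 14))

ψ-≥ : ∀ e l {d} → T (l ≤ᵇ 16384) → T (l * l * d ≤ᵇ 16384 * 16384) → 2 ^ e * l ≤ ψ e d
ψ-≥ e l {d} p q rewrite ^-distribˡ-+-* 2 e 14 =
  invSqrtLo-≥ (2 ^ e) (≤ᵇ⇒≤ l _ p) (≤ᵇ⇒≤ (l * l * d) _ q)

ψ-≤ : ∀ e u {d} → T (1 ≤ᵇ d) → T (16384 * 16384 ≤ᵇ u * u * d) → ψ e d ≤ 2 ^ e * u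
ψ-≤ e u {d} p q rewrite ^-distribˡ-+-* 2 e 14 =
  invSqrtLo-≤ (2 ^ e) (≤ᵇ⇒≤ 1 d p) (≤ᵇ⇒≤ _ (u * u * d) q)

bracket-gap : ∀ R {A B l u g} → R * l ≤ A → B ≤ R * u → g + u ≤ l → R * g + B ≤ A
bracket-gap R {A} {B} {l} {u} {g} Rl≤A B≤Ru g+u≤l = begin
  R * g + B     ≤⟨ +-monoʳ-≤ (R * g) B≤Ru ⟩
  R * g + R * u ≡⟨ *-distribˡ-+ R g u ⟨
  R * (g + u)   ≤⟨ *-monoʳ-≤ R g+u≤l ⟩
  R * l         ≤⟨ Rl≤A ⟩
  A             ∎
  where open ≤-Reasoning

-- The certificates are ⌊2¹⁴/√(2 + δ)⌋ and ⌈2¹⁴/√(3 + δ)⌉. The margin 405 exceeds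
-- 2¹⁴ (1/√3 + 1/√5 − 1) ≈ 402, the loss of the two path edges (see ψ5+ψ3≤ψ4+ψ4).
ψ-gap : ∀ e δ → δ ≤ 4 → 2 ^ e * 405 + ψ e (3 + δ) ≤ ψ e (2 + δ)
ψ-gap e 0 _ = bracket-gap (2 ^ e) (ψ-≥ e 11585 tt tt) (ψ-≤ e 9460 tt tt) (≤ᵇ⇒≤ 9865 11585 tt)
ψ-gap e 1 _ = bracket-gap (2 ^ e) (ψ-≥ e 9459 tt tt) (ψ-≤ e 8192 tt tt) (≤ᵇ⇒≤ 8597 9459 tt)
ψ-gap e 2 _ = bracket-gap (2 ^ e) (ψ-≥ e 8192 tt tt) (ψ-≤ e 7328 tt tt) (≤ᵇ⇒≤ 7733 8192 tt)
ψ-gap e 3 _ = bracket-gap (2 ^ e) (ψ-≥ e 7327 tt tt) (ψ-≤ e 6689 tt tt) (≤ᵇ⇒≤ 7094 7327 tt)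
ψ-gap e 4 _ = bracket-gap (2 ^ e) (ψ-≥ e 6688 tt tt) (ψ-≤ e 6193 tt tt) (≤ᵇ⇒≤ 6598 6688 tt)
ψ-gap e (suc (suc (suc (suc (suc δ))))) (s≤s (s≤s (s≤s (s≤s ()))))

ψ-gaps : ∀ e d d' → d ⊓ d' ≤ 4 →
  2 ^ e * 405 + (ψ e (3 + d) + ψ e (3 + d')) ≤ ψ e (2 + d) + ψ e (2 + d')
ψ-gaps e d d' min≤4 with ⊓-sel d d'
... | inj₁ min≡d = begin
  2 ^ e * 405 + (ψ e (3 + d) + ψ e (3 + d')) ≡⟨ +-assoc (2 ^ e * 405) _ _ ⟨
  2 ^ e * 405 + ψ e (3 + d) + ψ e (3 + d')   ≤⟨ +-mono-≤ (ψ-gap e d (subst (_≤ 4) min≡d min≤4))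
                                                         (ψ-antitone e (n≤1+n (2 + d'))) ⟩
  ψ e (2 + d) + ψ e (2 + d')                 ∎
  where open ≤-Reasoning
... | inj₂ min≡d' = begin
  2 ^ e * 405 + (ψ e (3 + d) + ψ e (3 + d')) ≡⟨ +-comm (2 ^ e * 405) _ ⟩
  ψ e (3 + d) + ψ e (3 + d') + 2 ^ e * 405   ≡⟨ +-assoc (ψ e (3 + d)) _ _ ⟩
  ψ e (3 + d) + (ψ e (3 + d') + 2 ^ e * 405) ≡⟨ cong (ψ e (3 + d) +_) (+-comm _ (2 ^ e * 405)) ⟩
  ψ e (3 + d) + (2 ^ e * 405 + ψ e (3 + d')) ≤⟨ +-mono-≤ (ψ-antitone e (n≤1+n (2 + d)))
                                                         (ψ-gap e d' (subst (_≤ 4) min≡d' min≤4)) ⟩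
  ψ e (2 + d) + ψ e (2 + d')                 ∎
  where open ≤-Reasoning

ψ5+ψ3≤ψ4+ψ4 : ∀ e → ψ e 5 + ψ e 3 + 2 ^ e ≤ ψ e 4 + ψ e 4 + 2 ^ e * 405
ψ5+ψ3≤ψ4+ψ4 e = begin
  ψ e 5 + ψ e 3 + R                ≤⟨ +-monoˡ-≤ R (+-mono-≤ (ψ-≤ e 7328 tt tt) (ψ-≤ e 9460 tt tt)) ⟩
  R * 7328 + R * 9460 + R          ≡⟨ solve 1 (λ R → R :* con 7328 :+ R :* con 9460 :+ R
                                                   := R :* con 8192 :+ R :* con 8192 :+ R :* con 405) refl R ⟩
  R * 8192 + R * 8192 + R * 405    ≤⟨ +-monoˡ-≤ (R * 405) (+-mono-≤ (ψ-≥ e 8192 tt tt) (ψ-≥ e 8192 tt tt)) ⟩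
  ψ e 4 + ψ e 4 + R * 405          ∎
  where
  open ≤-Reasoning
  open +-*-Solver
  R = 2 ^ e

combine-bounds : ∀ E A₃ B₃ Y A₂ B₂ X g → E + Y < g + X → g + (A₃ + B₃) ≤ A₂ + B₂ →
  E + (A₃ + (B₃ + Y)) < A₂ + (B₂ + X)
combine-bounds E A₃ B₃ Y A₂ B₂ X g rest pair = begin-strict
  E + (A₃ + (B₃ + Y)) ≡⟨ solve 4 (λ E Y A B → E :+ (A :+ (B :+ Y)) := A :+ B :+ (E :+ Y)) refl E Y A₃ B₃ ⟩
  A₃ + B₃ + (E + Y)   <⟨ +-monoʳ-< (A₃ + B₃) rest ⟩
  A₃ + B₃ + (g + X)   ≡⟨ solve 4 (λ X g A B → A :+ B :+ (g :+ X) := g :+ (A :+ B) :+ X) refl X g A₃ B₃ ⟩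
  g + (A₃ + B₃) + X   ≤⟨ +-monoˡ-≤ X pair ⟩
  A₂ + B₂ + X         ≡⟨ +-assoc A₂ B₂ X ⟩
  A₂ + (B₂ + X)       ∎
  where
  open ≤-Reasoning
  open +-*-Solver

short-path-bound : ∀ E d d' → d ⊓ d' ≤ 4 →
  E + (ψ E (3 + d) + (ψ E (3 + d') + (ψ E 4 + 0))) < ψ E (2 + d) + (ψ E (2 + d') + (ψ E 4 + 0))
short-path-bound E d d' min≤4 =
  combine-bounds E (ψ E (3 + d)) (ψ E (3 + d')) (ψ E 4 + 0) (ψ E (2 + d)) (ψ E (2 + d')) (ψ E 4 + 0) (2 ^ E * 405)
          (+-monoˡ-< (ψ E 4 + 0) (≤-trans (n<2^n E) (m≤m*n (2 ^ E) 405)))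
          (ψ-gaps E d d' min≤4)

long-path-bound : ∀ E d d' → d ⊓ d' ≤ 4 →
  E + (ψ E (3 + d) + (ψ E (3 + d') + (ψ E 5 + (ψ E 3 + 0))))
    < ψ E (2 + d) + (ψ E (2 + d') + (ψ E 4 + (ψ E 4 + 0)))
long-path-bound E d d' min≤4 =
  combine-bounds E (ψ E (3 + d)) (ψ E (3 + d')) (ψ E 5 + (ψ E 3 + 0)) (ψ E (2 + d)) (ψ E (2 + d'))
          (ψ E 4 + (ψ E 4 + 0)) (2 ^ E * 405) rest (ψ-gaps E d d' min≤4)
  where
  open ≤-Reasoning
  open +-*-Solver
  rest : E + (ψ E 5 + (ψ E 3 + 0)) < 2 ^ E * 405 + (ψ E 4 + (ψ E 4 + 0))
  rest = begin-strict
    E + (ψ E 5 + (ψ E 3 + 0))           ≡⟨ solve 3 (λ E A B → E :+ (A :+ (B :+ con 0)) := A :+ B :+ E)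
                                                   refl E (ψ E 5) (ψ E 3) ⟩
    ψ E 5 + ψ E 3 + E                   <⟨ +-monoʳ-< (ψ E 5 + ψ E 3) (n<2^n E) ⟩
    ψ E 5 + ψ E 3 + 2 ^ E               ≤⟨ ψ5+ψ3≤ψ4+ψ4 E ⟩
    ψ E 4 + ψ E 4 + 2 ^ E * 405         ≡⟨ solve 2 (λ A g → A :+ A :+ g := g :+ (A :+ (A :+ con 0)))
                                                   refl (ψ E 4) (2 ^ E * 405) ⟩
    2 ^ E * 405 + (ψ E 4 + (ψ E 4 + 0)) ∎

χ<-from-edgeSums : ∀ {N} {H H' : Adj N} e {X Y} → edgeSum H (ψ e) + X ≤ edgeSum H' (ψ e) + Y →
  length (edges H) + Y < X → H χ< H'
χ<-from-edgeSums {H = H} {H'} e {X} {Y} local E+Y<X = e + 14 , +-cancelʳ-< Y _ _ (begin-strict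
  χHi (e + 14) H + Y                          ≡⟨ cong (_+ Y) (χHi-edgeSum (e + 14) H) ⟩
  edgeSum H (ψ e) + length (edges H) + Y      ≡⟨ +-assoc (edgeSum H (ψ e)) _ Y ⟩
  edgeSum H (ψ e) + (length (edges H) + Y)    <⟨ +-monoʳ-< (edgeSum H (ψ e)) E+Y<X ⟩
  edgeSum H (ψ e) + X                         ≤⟨ local ⟩
  edgeSum H' (ψ e) + Y                        ∎)
  where open ≤-Reasoning

-- Attaching a path

module AttachPath {n : ℕ} (M : Adj n) (M-sym : ∀ i j → M i j ≡ M j i) (u : Fin n) (b : ℕ) where

  H : Adj (n + suc b)
  H = attachPath b M u

  ι : Fin n → Fin (n + suc b)
  ι v = v ↑ˡ suc b

  π : Fin (suc b) → Fin (n + suc b)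
  π p = n ↑ʳ p

  H-ιι : ∀ i j → H (ι i) (ι j) ≡ M i j
  H-ιι i j rewrite splitAt-↑ˡ n i (suc b) | splitAt-↑ˡ n j (suc b) = refl

  H-ιπ : ∀ i p → H (ι i) (π p) ≡ ⌊ i ≟ u ⌋ ∧ ⌊ toℕ p ℕ.≟ 0 ⌋
  H-ιπ i p rewrite splitAt-↑ˡ n i (suc b) | splitAt-↑ʳ n (suc b) p = refl

  H-πι : ∀ p i → H (π p) (ι i) ≡ ⌊ i ≟ u ⌋ ∧ ⌊ toℕ p ℕ.≟ 0 ⌋
  H-πι p i rewrite splitAt-↑ˡ n i (suc b) | splitAt-↑ʳ n (suc b) p = refl

  H-ππ : ∀ p q → H (π p) (π q) ≡ ⌊ suc (toℕ p) ℕ.≟ toℕ q ⌋ ∨ ⌊ suc (toℕ q) ℕ.≟ toℕ p ⌋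
  H-ππ p q rewrite splitAt-↑ʳ n (suc b) p | splitAt-↑ʳ n (suc b) q = refl

  data View : Fin (n + suc b) → Set where
    old : ∀ v → View (ι v)
    new : ∀ p → View (π p)

  view : ∀ x → View x
  view x with splitAt n x in eq
  ... | inj₁ v = subst View (splitAt⁻¹-↑ˡ eq) (old v)
  ... | inj₂ p = subst View (splitAt⁻¹-↑ʳ eq) (new p)

  H-sym : ∀ x y → H x y ≡ H y x
  H-sym x y with view x | view y
  ... | old i | old j = trans (H-ιι i j) (trans (M-sym i j) (sym (H-ιι j i)))
  ... | old i | new q = trans (H-ιπ i q) (sym (H-πι q i))
  ... | new p | old j = trans (H-πι p j) (sym (H-ιπ j p))
  ... | new p | new q = trans (H-ππ p q) (trans (∨-comm ⌊ suc (toℕ p) ℕ.≟ toℕ q ⌋ _) (sym (H-ππ q p)))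

  ι≢π : ∀ {i p} → ι i ≢ π p
  ι≢π {i} {p} eq = <⇒≢ (≤-trans (toℕ<n i) (m≤m+n n (toℕ p)))
                        (trans (sym (toℕ-↑ˡ i (suc b))) (trans (cong toℕ eq) (toℕ-↑ʳ n p)))

  ι-≢ : ∀ {i j} → i ≢ j → ι i ≢ ι j
  ι-≢ {i} {j} i≢j = i≢j ∘ ↑ˡ-injective (suc b) i j

  π-≢ : ∀ {p q} → toℕ p ≢ toℕ q → π p ≢ π q
  π-≢ {p} {q} p≢q = p≢q ∘ cong toℕ ∘ ↑ʳ-injective n p q

  deg-split : ∀ x → deg H x ≡ ∑[ v < n ] 𝟙 (H x (ι v)) + ∑[ p < suc b ] 𝟙 (H x (π p))
  deg-split x = trans (deg-∑ H x) (∑-↑ n (λ y → 𝟙 (H x y)))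

  deg-ι : ∀ v → deg H (ι v) ≡ deg M v + 𝟙 ⌊ v ≟ u ⌋
  deg-ι v = trans (deg-split (ι v))
                  (cong₂ _+_ (trans (sum-cong-≗ {n} (cong 𝟙 ∘ H-ιι v)) (sym (deg-∑ M v)))
                             (trans (sum-cong-≗ {suc b} (cong 𝟙 ∘ H-ιπ v)) (path-part ⌊ v ≟ u ⌋)))
    where
    path-part : ∀ c → ∑[ p < suc b ] 𝟙 (c ∧ ⌊ toℕ p ℕ.≟ 0 ⌋) ≡ 𝟙 c
    path-part true = cong suc (∑-zero b)
    path-part false = ∑-zero (suc b)

  attachment : ∀ p → ∑[ v < n ] 𝟙 (H (π p) (ι v)) ≡ 𝟙 ⌊ toℕ p ℕ.≟ 0 ⌋
  attachment p = trans (sum-cong-≗ {n} (cong 𝟙 ∘ H-πι p)) (at-u ⌊ toℕ p ℕ.≟ 0 ⌋)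
    where
    at-u : ∀ c → ∑[ v < n ] 𝟙 (⌊ v ≟ u ⌋ ∧ c) ≡ 𝟙 c
    at-u true = trans (sum-cong-≗ {n} (λ v → cong 𝟙 (∧-identityʳ ⌊ v ≟ u ⌋))) (∑-δ u (λ _ → 1))
    at-u false = trans (sum-cong-≗ {n} (λ v → cong 𝟙 (∧-zeroʳ ⌊ v ≟ u ⌋))) (∑-zero n)

  successors : ∀ (p : Fin (suc b)) →
    ∑[ q < suc b ] 𝟙 ⌊ suc (toℕ p) ℕ.≟ toℕ q ⌋ ≡ 𝟙 ⌊ toℕ p ℕ.<? b ⌋
  successors p = trans (∑-𝟙-toℕ (suc b) (suc (toℕ p))) (cong 𝟙 (<?-suc (toℕ p) b))

  predecessors : ∀ (p : Fin (suc b)) →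
    ∑[ q < suc b ] 𝟙 ⌊ suc (toℕ q) ℕ.≟ toℕ p ⌋ ≡ 𝟙 (not ⌊ toℕ p ℕ.≟ 0 ⌋)
  predecessors zero = ∑-zero (suc b)
  predecessors (suc p) = begin
    ∑[ q < suc b ] 𝟙 ⌊ suc (toℕ q) ℕ.≟ suc (toℕ p) ⌋
      ≡⟨ sum-cong-≗ {suc b} (λ q → cong 𝟙 (trans (ℕ≟-suc (toℕ q) (toℕ p)) (ℕ≟-sym (toℕ q) _))) ⟩
    ∑[ q < suc b ] 𝟙 ⌊ toℕ p ℕ.≟ toℕ q ⌋
      ≡⟨ ∑-𝟙-toℕ (suc b) (toℕ p) ⟩
    𝟙 ⌊ toℕ p ℕ.<? suc b ⌋
      ≡⟨ cong 𝟙 (⌊⌋-true (toℕ p ℕ.<? suc b) (m<n⇒m<1+n (toℕ<n p))) ⟩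
    1 ∎
    where open ≡-Reasoning

  path-neighbours : ∀ p →
    ∑[ q < suc b ] 𝟙 (H (π p) (π q)) ≡ 𝟙 ⌊ toℕ p ℕ.<? b ⌋ + 𝟙 (not ⌊ toℕ p ℕ.≟ 0 ⌋)
  path-neighbours p = begin
    ∑[ q < suc b ] 𝟙 (H (π p) (π q))
      ≡⟨ sum-cong-≗ {suc b} (λ q → trans (cong 𝟙 (H-ππ p q)) (exclusive q)) ⟩
    ∑[ q < suc b ] (forward q + backward q)
      ≡⟨ ∑-distrib-+ {suc b} forward backward ⟩
    ∑[ q < suc b ] forward q + ∑[ q < suc b ] backward q
      ≡⟨ cong₂ _+_ (successors p) (predecessors p) ⟩
    𝟙 ⌊ toℕ p ℕ.<? b ⌋ + 𝟙 (not ⌊ toℕ p ℕ.≟ 0 ⌋) ∎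
    where
    open ≡-Reasoning
    forward backward : Fin (suc b) → ℕ
    forward q = 𝟙 ⌊ suc (toℕ p) ℕ.≟ toℕ q ⌋
    backward q = 𝟙 ⌊ suc (toℕ q) ℕ.≟ toℕ p ⌋
    exclusive : ∀ q → 𝟙 (⌊ suc (toℕ p) ℕ.≟ toℕ q ⌋ ∨ ⌊ suc (toℕ q) ℕ.≟ toℕ p ⌋)
                      ≡ forward q + backward q
    exclusive q = if-∨ ⌊ suc (toℕ p) ℕ.≟ toℕ q ⌋ ⌊ suc (toℕ q) ℕ.≟ toℕ p ⌋ 1 λ p<q q<p →
      <-asym (≤-reflexive (⌊⌋-sound (_ ℕ.≟ _) p<q)) (≤-reflexive (⌊⌋-sound (_ ℕ.≟ _) q<p))

  deg-π : ∀ p → deg H (π p) ≡ suc (𝟙 ⌊ toℕ p ℕ.<? b ⌋)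
  deg-π p = trans (deg-split (π p))
                  (trans (cong₂ _+_ (attachment p) (path-neighbours p)) (𝟙-split ⌊ toℕ p ℕ.≟ 0 ⌋ _))
    where
    𝟙-split : ∀ c s → 𝟙 c + (s + 𝟙 (not c)) ≡ suc s
    𝟙-split true s = cong suc (+-identityʳ s)
    𝟙-split false s = +-comm s 1

  deg-pendant : deg H (π (fromℕ b)) ≡ 1
  deg-pendant = trans (deg-π (fromℕ b))
                      (cong (suc ∘ 𝟙) (⌊⌋-false (_ ℕ.<? b) (n≮n b ∘ subst (_< b) (toℕ-fromℕ b))))

  deg-inner : ∀ {p} → toℕ p < b → deg H (π p) ≡ 2
  deg-inner {p} p<b = trans (deg-π p) (cong (suc ∘ 𝟙) (⌊⌋-true (toℕ p ℕ.<? b) p<b))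

-- The transformation H ↦ H'

module Transformation {n : ℕ} (M : Adj n) (M-sym : ∀ i j → M i j ≡ M j i) (M-loop : ∀ i → M i i ≡ false)
  {u u₁ u₂ : Fin n} (deg-u : deg M u ≡ 2) (Muu₁ : M u u₁ ≡ true) (Muu₂ : M u u₂ ≡ true)
  (u₁≢u₂ : u₁ ≢ u₂) (b : ℕ) where

  open AttachPath M M-sym u b public

  -- u, u₁, u₂ and the pendant vertex u' of the paper, as vertices of H; p₀ is the path vertex next to u
  a w z a' p₀ : Fin (n + suc b)
  a = ι u
  w = ι u₁
  z = ι u₂
  a' = π (fromℕ b)
  p₀ = π zero

  a≢w : a ≢ w
  a≢w = ι-≢ (adjacent-≢ M-loop Muu₁)
  a≢z : a ≢ z
  a≢z = ι-≢ (adjacent-≢ M-loop Muu₂)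
  w≢z : w ≢ z
  w≢z = ι-≢ u₁≢u₂

  Haw : H a w ≡ true
  Haw = trans (H-ιι u u₁) Muu₁
  Haz : H a z ≡ true
  Haz = trans (H-ιι u u₂) Muu₂
  Hap₀ : H a p₀ ≡ true
  Hap₀ = trans (H-ιπ u zero) (cong (_∧ true) (⌊⌋-true (u ≟ u) refl))
  Ha'z : H a' z ≡ false
  Ha'z = trans (H-πι (fromℕ b) u₂) (cong (_∧ _) (⌊⌋-false (u₂ ≟ u) (a≢z ∘ cong ι ∘ sym)))

  deg-a : deg H a ≡ 3
  deg-a = trans (deg-ι u) (cong₂ _+_ deg-u (cong 𝟙 (⌊⌋-true (u ≟ u) refl)))

  neighbours-a : ∀ {y} → H a y ≡ true → y ≡ w ⊎ y ≡ z ⊎ y ≡ p₀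
  neighbours-a {y} Hay with view y
  ... | old v = map-⊎ (cong ι) (inj₁ ∘ cong ι)
                      (neighbours-of-deg-2 M deg-u Muu₁ Muu₂ u₁≢u₂ (trans (sym (H-ιι u v)) Hay))
  ... | new q = inj₂ (inj₂ (cong π (toℕ-injective q≡0)))
    where q≡0 = ⌊⌋-sound (_ ℕ.≟ 0) (proj₂ (∧-true⇒ (trans (sym (H-ιπ u q)) Hay)))

  neighbours-a' : ∀ {y} → H a' y ≡ true →
    (b ≡ 0 × y ≡ a) ⊎ Σ (Fin (suc b)) (λ q → suc (toℕ q) ≡ b × y ≡ π q)
  neighbours-a' {y} Ha'y with view y
  ... | old v = inj₁ (trans (sym (toℕ-fromℕ b)) (⌊⌋-sound (_ ℕ.≟ 0) (proj₂ attached)) ,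
                      cong ι (⌊⌋-sound (v ≟ u) (proj₁ attached)))
    where attached = ∧-true⇒ (trans (sym (H-πι (fromℕ b) v)) Ha'y)
  ... | new q with ∨-true⇒ (trans (sym (H-ππ (fromℕ b) q)) Ha'y)
  ...   | inj₁ b+1≡q =
    ⊥-elim (<-irrefl (trans (sym (⌊⌋-sound (_ ℕ.≟ _) b+1≡q)) (cong suc (toℕ-fromℕ b))) (toℕ<n q))
  ...   | inj₂ q+1≡b = inj₂ (q , trans (⌊⌋-sound (_ ℕ.≟ _) q+1≡b) (toℕ-fromℕ b) , refl)

  H' : Adj (n + suc b)
  H' = moveEdge H a z a' z

  module Move = MoveEdge H H-sym a≢z ι≢π ι≢π Haz Ha'z

  deg'-a : deg H' a ≡ 2
  deg'-a = +-cancelʳ-≡ 1 _ _ (trans Move.deg-a deg-a)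

  deg'-a' : deg H' a' ≡ 2
  deg'-a' = trans (sym Move.deg-a') (cong (_+ 1) deg-pendant)

  deg'-w : deg H' w ≡ deg H w
  deg'-w = Move.deg-outside (a≢w ∘ sym) ι≢π

  H'aw : H' a w ≡ true
  H'aw = trans (Move.G'-a w≢z) Haw

  H'ap₀ : H' a p₀ ≡ true
  H'ap₀ = trans (Move.G'-a (ι≢π ∘ sym)) Hap₀

  open LocalChange H H' H-sym Move.G'-outside Move.deg-outside public

module ShortPath {n : ℕ} (M : Adj n) (M-sym : ∀ i j → M i j ≡ M j i) (M-loop : ∀ i → M i i ≡ false)
  {u u₁ u₂ : Fin n} (deg-u : deg M u ≡ 2) (Muu₁ : M u u₁ ≡ true) (Muu₂ : M u u₂ ≡ true)
  (u₁≢u₂ : u₁ ≢ u₂) where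

  open Transformation M M-sym M-loop deg-u Muu₁ Muu₂ u₁≢u₂ 0

  qs qs' : List (Fin (n + 1) × Fin (n + 1))
  qs = (a , w) ∷ (a , z) ∷ (a , a') ∷ []
  qs' = (a , w) ∷ (a' , z) ∷ (a , a') ∷ []

  covers-a : Covers a qs
  covers-a y Hay with neighbours-a Hay
  ... | inj₁ refl = here (onPair-here a w)
  ... | inj₂ (inj₁ refl) = there (here (onPair-here a z))
  ... | inj₂ (inj₂ refl) = there (there (here (onPair-here a a')))

  covers-a' : Covers a' qs
  covers-a' y Ha'y with neighbours-a' Ha'y
  ... | inj₁ (_ , refl) = there (there (here (onPair-flip a a')))
  ... | inj₂ (_ , () , _)

  meets : All Meets qs'
  meets = inj₁ (inj₁ refl) ∷ inj₁ (inj₂ refl) ∷ inj₁ (inj₁ refl) ∷ []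

  apart' : AllPairs Apart qs'
  apart' = (apart (ι≢π ∘ proj₁) (a≢z ∘ proj₁) ∷ apart (ι≢π ∘ proj₂) (ι≢π ∘ proj₁) ∷ [])
         ∷ (apart (ι≢π ∘ sym ∘ proj₁) (a≢z ∘ sym ∘ proj₂) ∷ [])
         ∷ [] ∷ []

  module _ (f : ℕ → ℕ) where

    H-values : pairSum H f qs ≡ f (3 + deg H w) + (f (3 + deg H z) + (f 4 + 0))
    H-values = cong₂ _+_ (pairPart-edge H H-sym f a≢w Haw deg-a refl)
                 (cong₂ _+_ (pairPart-edge H H-sym f a≢z Haz deg-a refl)
                   (cong (_+ 0) (pairPart-edge H H-sym f ι≢π Hap₀ deg-a deg-pendant)))

    H'-values : pairSum H' f qs' ≡ f (2 + deg H w) + (f (2 + deg H z) + (f 4 + 0))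
    H'-values = cong₂ _+_ (pairPart-edge H' Move.G'-sym f a≢w H'aw deg'-a deg'-w)
                  (cong₂ _+_ (pairPart-edge H' Move.G'-sym f (ι≢π ∘ sym) Move.G'-a'z deg'-a' Move.deg-z)
                    (cong (_+ 0) (pairPart-edge H' Move.G'-sym f ι≢π H'ap₀ deg'-a deg'-a')))

  χ-increases : deg H w ⊓ deg H z ≤ 4 → H χ< H'
  χ-increases min≤4 =
    χ<-from-edgeSums {H = H} {H'} E (edgeSum-local (ψ E) qs qs' covers-a covers-a' meets apart')
      (subst₂ (λ Y X → E + Y < X) (sym (H-values (ψ E))) (sym (H'-values (ψ E)))
              (short-path-bound E (deg H w) (deg H z) min≤4))
    where
    E = length (edges H)

module LongPath {n : ℕ} (M : Adj n) (M-sym : ∀ i j → M i j ≡ M j i) (M-loop : ∀ i → M i i ≡ false)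
  {u u₁ u₂ : Fin n} (deg-u : deg M u ≡ 2) (Muu₁ : M u u₁ ≡ true) (Muu₂ : M u u₂ ≡ true)
  (u₁≢u₂ : u₁ ≢ u₂) (c : ℕ) where

  open Transformation M M-sym M-loop deg-u Muu₁ Muu₂ u₁≢u₂ (suc c)

  q₀ : Fin (suc (suc c))
  q₀ = inject₁ (fromℕ c)

  toℕ-q₀ : toℕ q₀ ≡ c
  toℕ-q₀ = trans (toℕ-inject₁ (fromℕ c)) (toℕ-fromℕ c)

  v : Fin (n + suc (suc c))
  v = π q₀

  v≢a' : v ≢ a'
  v≢a' = π-≢ λ c≡1+c → <-irrefl (trans (sym toℕ-q₀) (trans c≡1+c (toℕ-fromℕ (suc c)))) (n<1+n c)

  p₀≢a' : p₀ ≢ a'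
  p₀≢a' = π-≢ λ ()

  Hva' : H v a' ≡ true
  Hva' = trans (H-ππ q₀ (fromℕ (suc c)))
               (cong (_∨ ⌊ suc (toℕ (fromℕ (suc c))) ℕ.≟ toℕ q₀ ⌋)
                     (⌊⌋-true (_ ℕ.≟ _) (trans (cong suc toℕ-q₀) (sym (toℕ-fromℕ (suc c))))))

  deg-p₀ : deg H p₀ ≡ 2
  deg-p₀ = deg-inner (s≤s z≤n)

  deg-v : deg H v ≡ 2
  deg-v = deg-inner (subst (_< suc c) (sym toℕ-q₀) (n<1+n c))

  deg'-p₀ : deg H' p₀ ≡ 2
  deg'-p₀ = trans (Move.deg-outside (ι≢π ∘ sym) p₀≢a') deg-p₀

  deg'-v : deg H' v ≡ 2
  deg'-v = trans (Move.deg-outside (ι≢π ∘ sym) v≢a') deg-v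

  H'va' : H' v a' ≡ true
  H'va' = trans (Move.G'-row a' (ι≢π ∘ sym) (ι≢π ∘ sym) v≢a') Hva'

  qs qs' : List (Fin (n + suc (suc c)) × Fin (n + suc (suc c)))
  qs = (a , w) ∷ (a , z) ∷ (a , p₀) ∷ (v , a') ∷ []
  qs' = (a , w) ∷ (a' , z) ∷ (a , p₀) ∷ (v , a') ∷ []

  covers-a : Covers a qs
  covers-a y Hay with neighbours-a Hay
  ... | inj₁ refl = here (onPair-here a w)
  ... | inj₂ (inj₁ refl) = there (here (onPair-here a z))
  ... | inj₂ (inj₂ refl) = there (there (here (onPair-here a p₀)))

  covers-a' : Covers a' qs
  covers-a' y Ha'y with neighbours-a' Ha'y
  ... | inj₁ (() , _)
  ... | inj₂ (q , q+1≡b , refl)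
    rewrite toℕ-injective {i = q} {j = q₀} (trans (suc-injective q+1≡b) (sym toℕ-q₀)) =
    there (there (there (here (onPair-flip v a'))))

  meets : All Meets qs'
  meets = inj₁ (inj₁ refl) ∷ inj₁ (inj₂ refl) ∷ inj₁ (inj₁ refl) ∷ inj₂ (inj₂ refl) ∷ []

  apart' : AllPairs Apart qs'
  apart' = (apart (ι≢π ∘ proj₁) (a≢z ∘ proj₁)
           ∷ apart (ι≢π ∘ proj₂) (ι≢π ∘ proj₁)
           ∷ apart (ι≢π ∘ proj₁) (ι≢π ∘ proj₁) ∷ [])
         ∷ (apart (ι≢π ∘ sym ∘ proj₁) (p₀≢a' ∘ sym ∘ proj₁)
           ∷ apart (v≢a' ∘ sym ∘ proj₁) (ι≢π ∘ proj₂) ∷ [])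
         ∷ (apart (ι≢π ∘ proj₁) (ι≢π ∘ proj₁) ∷ [])
         ∷ [] ∷ []

  module _ (f : ℕ → ℕ) where

    H-values : pairSum H f qs ≡ f (3 + deg H w) + (f (3 + deg H z) + (f 5 + (f 3 + 0)))
    H-values = cong₂ _+_ (pairPart-edge H H-sym f a≢w Haw deg-a refl)
                 (cong₂ _+_ (pairPart-edge H H-sym f a≢z Haz deg-a refl)
                   (cong₂ _+_ (pairPart-edge H H-sym f ι≢π Hap₀ deg-a deg-p₀)
                     (cong (_+ 0) (pairPart-edge H H-sym f v≢a' Hva' deg-v deg-pendant))))

    H'-values : pairSum H' f qs' ≡ f (2 + deg H w) + (f (2 + deg H z) + (f 4 + (f 4 + 0)))
    H'-values = cong₂ _+_ (pairPart-edge H' Move.G'-sym f a≢w H'aw deg'-a deg'-w)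
                  (cong₂ _+_ (pairPart-edge H' Move.G'-sym f (ι≢π ∘ sym) Move.G'-a'z deg'-a' Move.deg-z)
                    (cong₂ _+_ (pairPart-edge H' Move.G'-sym f ι≢π H'ap₀ deg'-a deg'-p₀)
                      (cong (_+ 0) (pairPart-edge H' Move.G'-sym f v≢a' H'va' deg'-v deg'-a'))))

  χ-increases : deg H w ⊓ deg H z ≤ 4 → H χ< H'
  χ-increases min≤4 =
    χ<-from-edgeSums {H = H} {H'} E (edgeSum-local (ψ E) qs qs' covers-a covers-a' meets apart')
      (subst₂ (λ Y X → E + Y < X) (sym (H-values (ψ E))) (sym (H'-values (ψ E)))
              (long-path-bound E (deg H w) (deg H z) min≤4))
    where
    E = length (edges H)

lemma2 : ∀ (n : ℕ) (M : Adj n) → IsSimple M → Connected M → 3 ≤ n →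
    ∀ (u u₁ u₂ : Fin n) → deg M u ≡ 2 → M u u₁ ≡ true → M u u₂ ≡ true → u₁ ≢ u₂ →
    ∀ (b : ℕ) →
    let H = attachPath b M u
        ι = λ (v : Fin n) → v ↑ˡ suc b
    in deg H (ι u₁) ⊓ deg H (ι u₂) ≤ 4 →
       H χ< moveEdge H (ι u) (ι u₂) (pendant n b) (ι u₂)
lemma2 n M (M-sym , M-loop) _ _ u u₁ u₂ deg-u Muu₁ Muu₂ u₁≢u₂ zero =
  ShortPath.χ-increases M M-sym M-loop deg-u Muu₁ Muu₂ u₁≢u₂
lemma2 n M (M-sym , M-loop) _ _ u u₁ u₂ deg-u Muu₁ Muu₂ u₁≢u₂ (suc c) =
  LongPath.χ-increases M M-sym M-loop deg-u Muu₁ Muu₂ u₁≢u₂ c
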